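{- Let $a,b,k$ be positive integers with $k\ge 2$ and $a\le b$. If $a+b\le k$, then $\gamma_{k{\rm rt}}(K_{a,b})=a+b$. If $a+b>k$, then $$\gamma_{k{\rm rt}}(K_{a,b})=\begin{cases} k, & \text{if } a\le \lfloor k/2\rfloor,\\ a+\lceil (k+1)/2\rceil, & \text{if } \lfloor k/2\rfloor<a<\lceil (3k-2)/2\rceil,\\ 2k, & \text{if } a\ge \lceil (3k-2)/2\rceil.\end{cases}$$
   Context: All graphs are finite, simple and undirected; $N(v)$ denotes the open neighborhood of $v$, and $[k]=\{1,\dots,k\}$. A $k$-rainbow total dominating function ($k$RTDF) of a graph $G$ is a function $f:V(G)\to 2^{[k]}$ such that (i) every vertex $v$ with $f(v)=\emptyset$ satisfies $\bigcup_{u\in N(v)}f(u)=[k]$, and (ii) for every vertex $v$ with $f(v)=\{i\}$ for some $i\in[k]$ there is $u\in N(v)$ with $i\in f(u)$. Its weight is $\|f\|=\sum_{v\in V(G)}|f(v)|$, and $\gamma_{k{\rm rt}}(G)$ is the minimum weight of a $k$RTDF of $G$. $K_{a,b}$ denotes the complete bipartite graph with parts of sizes $a$ and $b$. -}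

module Defs where

open import Data.Nat using (ℕ; _+_; _<_; _≤_)
open import Data.Fin using (Fin; toℕ)
open import Data.Fin.Subset using (Subset; _∈_; ⁅_⁆; ∣_∣; ⊥)
open import Data.List using (map; allFin)
open import Data.Nat.ListAction using (sum)
open import Data.Product using (Σ; _×_; ∃)
open import Data.Sum using (_⊎_)
open import Relation.Binary.PropositionalEquality using (_≡_)
import Data.Empty as E

record Graph : Set₁ where
  field
    n     : ℕ
    Adj   : Fin n → Fin n → Set
    irrefl : ∀ u → Adj u u → E.⊥
    sym   : ∀ u v → Adj u v → Adj v u

open Graph public

-- Complete bipartite graph K_{a,b}: vertices 0..a-1 form one part,
-- vertices a..a+b-1 the other; adjacent iff in different parts.
K : ℕ → ℕ → Graph
K a b = record
  { n = a + b
  ; Adj = λ u v → (toℕ u < a × a ≤ toℕ v) ⊎ (a ≤ toℕ u × toℕ v < a)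
  ; irrefl = irr
  ; sym = sy
  }
  where
  open import Data.Nat.Properties using (<⇒≱)
  open import Data.Sum using (inj₁; inj₂)
  open import Data.Product using (_,_)
  irr : ∀ (u : Fin (a + b)) → (toℕ u < a × a ≤ toℕ u) ⊎ (a ≤ toℕ u × toℕ u < a) → E.⊥
  irr u (inj₁ (p , q)) = <⇒≱ p q
  irr u (inj₂ (q , p)) = <⇒≱ p q
  sy : ∀ (u v : Fin (a + b)) → (toℕ u < a × a ≤ toℕ v) ⊎ (a ≤ toℕ u × toℕ v < a)
     → (toℕ v < a × a ≤ toℕ u) ⊎ (a ≤ toℕ v × toℕ u < a)
  sy u v (inj₁ (p , q)) = inj₂ (q , p)
  sy u v (inj₂ (p , q)) = inj₁ (q , p)

record IsKRTDF (k : ℕ) (G : Graph) (f : Fin (n G) → Subset k) : Set where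
  field
    empty-cond : ∀ v → f v ≡ ⊥ → ∀ (i : Fin k) → ∃ λ u → Adj G v u × i ∈ f u
    single-cond : ∀ v (i : Fin k) → f v ≡ ⁅ i ⁆ → ∃ λ u → Adj G v u × i ∈ f u

weight : ∀ {k} (G : Graph) → (Fin (n G) → Subset k) → ℕ
weight G f = sum (map (λ v → ∣ f v ∣) (allFin (n G)))

γkrt≡ : ℕ → Graph → ℕ → Set
γkrt≡ k G w =
  (Σ (Fin (n G) → Subset k) λ f → IsKRTDF k G f × weight G f ≡ w)
  × (∀ f → IsKRTDF k G f → w ≤ weight G f)

module Submission where

-- A colouring f of K a b is a pair of families gA, gB of colour sets on the two
-- parts, and as the neighbourhood of a vertex is the other part, f is a kRTDF iff
-- every set of one family is dominated by the colours occurring in the other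
-- ('BipartiteRTDF'); its weight is the total size of both families.
-- Lower bound: split on which parts cover all k colours.  Two covering parts cost
-- 2k; with none, no vertex may be empty, costing a + b.  If only A covers, let X
-- be the colours occurring on B and Y the rest: A-sets are nonempty and a
-- singleton A-set has its colour in X, so 2|p| ≥ 2 + |p ∩ Y|; summing over A
-- (which covers Y) gives 2wA ≥ 2a + |Y|, and wB ≥ |X|, so 2W ≥ 2a + k + 1 unless
-- X = ∅, when every A-set has two colours and W ≥ 2a ('Admissible').
-- Upper bound: explicit families (colour 0 everywhere; blocks of two or more
-- colours on A; a mixture of both; all colours on one vertex of each part).

open import Defs hiding (sym)
open import Data.Nat using (ℕ; zero; suc; _+_; _*_; _∸_; _<_; _≤_; z≤n; s≤s; ⌊_/2⌋; ⌈_/2⌉)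
open import Data.Nat.Properties
open import Data.Nat.Tactic.RingSolver using (solve-∀)
import Data.Nat.ListAction as List
open import Algebra.Properties.CommutativeMonoid.Sum +-0-commutativeMonoid
  using (sum; sum-cong-≗; ∑-distrib-+)
open import Data.Fin using (Fin; zero; suc; toℕ; _↑ˡ_; _↑ʳ_; splitAt)
open import Data.Fin.Properties using (toℕ-↑ˡ; toℕ-↑ʳ; toℕ<n; splitAt-↑ˡ; splitAt-↑ʳ;
  splitAt⁻¹-↑ˡ; splitAt⁻¹-↑ʳ; any?; all?)
open import Data.Fin.Subset using (Subset; inside; outside; _∈_; _∉_; _⊆_; _∪_; _∩_; ∁;
  ⊥; ⊤; ⁅_⁆; ∣_∣)
open import Data.Fin.Subset.Properties using (_∈?_; ∉⊥; ∈⊤; ∣⊥∣≡0; ∣⊤∣≡n; ∣⁅x⁆∣≡1;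
  x∈⁅x⁆; x∈⁅y⁆⇒x≡y; p⊆q⇒∣p∣≤∣q∣; x∈p∪q⁺; x∈p∩q⁺; ∣p∩q∣≤∣p∣; x∈p⇒∣p-x∣<∣p∣;
  x∈p∩q⁻; x∈p⇒x∉∁p; ∣∁p∣≡n∸∣p∣; ∣p∣≤n)
open import Data.Vec.Base using ([]; _∷_; here; there)
open import Data.Vec.Functional using (_++_)
import Data.List.Base as L
open import Data.List.Properties using (map-tabulate)
open import Data.Product using (Σ; _×_; _,_; ∃)
open import Data.Sum using (_⊎_; inj₁; inj₂; [_,_])
open import Data.Empty using (⊥-elim)
open import Function using (_∘_)
open import Relation.Nullary using (¬_; Dec; yes; no)
open import Relation.Binary.PropositionalEquality
  using (_≡_; refl; sym; trans; cong; cong₂; subst; subst₂; module ≡-Reasoning)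

∑-mono : ∀ {n} {g h : Fin n → ℕ} → (∀ j → g j ≤ h j) → sum g ≤ sum h
∑-mono {zero}  _   = z≤n
∑-mono {suc n} g≤h = +-mono-≤ (g≤h zero) (∑-mono (g≤h ∘ suc))

∑-const : ∀ n c → sum {n} (λ _ → c) ≡ n * c
∑-const zero    c = refl
∑-const (suc n) c = cong (c +_) (∑-const n c)

∑-lower : ∀ {n c} {g : Fin n → ℕ} → (∀ j → c ≤ g j) → n * c ≤ sum g
∑-lower {n} {c} c≤g = ≤-trans (≤-reflexive (sym (∑-const n c))) (∑-mono c≤g)

∑-split : ∀ m {n} (g : Fin (m + n) → ℕ) → sum g ≡ sum (g ∘ (_↑ˡ n)) + sum (g ∘ (m ↑ʳ_))
∑-split zero    g = refl
∑-split (suc m) g = trans (cong (g zero +_) (∑-split m (g ∘ suc))) (sym (+-assoc (g zero) _ _))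

listSum-tabulate : ∀ {n} (g : Fin n → ℕ) → List.sum (L.tabulate g) ≡ sum g
listSum-tabulate {zero}  g = refl
listSum-tabulate {suc n} g = cong (g zero +_) (listSum-tabulate (g ∘ suc))

⌊m+m+n/2⌋ : ∀ m n → ⌊ (m + m) + n /2⌋ ≡ m + ⌊ n /2⌋
⌊m+m+n/2⌋ zero    n = refl
⌊m+m+n/2⌋ (suc m) n rewrite +-suc m m = cong suc (⌊m+m+n/2⌋ m n)

⌈m+m+n/2⌉ : ∀ m n → ⌈ (m + m) + n /2⌉ ≡ m + ⌈ n /2⌉
⌈m+m+n/2⌉ m n = trans (cong ⌊_/2⌋ (sym (+-suc (m + m) n))) (⌊m+m+n/2⌋ m (suc n))

halve : ∀ m n w → (m + m) + n ≤ w + w → m + ⌈ n /2⌉ ≤ w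
halve m n w h = begin
  m + ⌈ n /2⌉          ≡⟨ sym (⌈m+m+n/2⌉ m n) ⟩
  ⌈ (m + m) + n /2⌉    ≤⟨ ⌈n/2⌉-mono h ⟩
  ⌈ w + w /2⌉          ≡⟨ sym (n≡⌈n+n/2⌉ w) ⟩
  w                    ∎
  where open ≤-Reasoning

double : ∀ m → m * 2 ≡ m + m
double m = trans (*-comm m 2) (cong (m +_) (+-identityʳ m))

total : ∀ {n k} → (Fin n → Subset k) → ℕ
total g = sum (λ j → ∣ g j ∣)

Occurs : ∀ {n k} → (Fin n → Subset k) → Fin k → Set
Occurs g i = ∃ λ j → i ∈ g j

Covers : ∀ {n k} → (Fin n → Subset k) → Set
Covers g = ∀ i → Occurs g i

covers? : ∀ {n k} (g : Fin n → Subset k) → Dec (Covers g)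
covers? g = all? (λ i → any? (λ j → i ∈? g j))

data Shape {k} (p : Subset k) : Set where
  empty     : p ≡ ⊥ → Shape p
  singleton : ∀ i → p ≡ ⁅ i ⁆ → Shape p
  large     : 2 ≤ ∣ p ∣ → Shape p

shape : ∀ {k} (p : Subset k) → Shape p
shape [] = empty refl
shape (outside ∷ p) with shape p
... | empty e       = empty (cong (outside ∷_) e)
... | singleton i e = singleton (suc i) (cong (outside ∷_) e)
... | large l       = large l
shape (inside ∷ p) with shape p
... | empty e       = singleton zero (cong (inside ∷_) e)
... | singleton i e = large (s≤s (≤-reflexive (sym (trans (cong ∣_∣ e) (∣⁅x⁆∣≡1 i)))))
... | large l       = large (m≤n⇒m≤1+n l)

member⇒positive : ∀ {k} {i : Fin k} {p} → i ∈ p → 1 ≤ ∣ p ∣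
member⇒positive i∈p = ≤-trans (s≤s z≤n) (x∈p⇒∣p-x∣<∣p∣ i∈p)

nonempty⇒positive : ∀ {k} (p : Subset k) → ¬ p ≡ ⊥ → 1 ≤ ∣ p ∣
nonempty⇒positive p p≢⊥ with shape p
... | empty e       = ⊥-elim (p≢⊥ e)
... | singleton i e = member⇒positive (subst (i ∈_) (sym e) (x∈⁅x⁆ i))
... | large l       = ≤-trans (s≤s z≤n) l

∣p∣+∣∁p∣≡n : ∀ {k} (p : Subset k) → ∣ p ∣ + ∣ ∁ p ∣ ≡ k
∣p∣+∣∁p∣≡n p = trans (cong (∣ p ∣ +_) (∣∁p∣≡n∸∣p∣ p)) (m+[n∸m]≡n (∣p∣≤n p))

∣p∪q∣≤∣p∣+∣q∣ : ∀ {k} (p q : Subset k) → ∣ p ∪ q ∣ ≤ ∣ p ∣ + ∣ q ∣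
∣p∪q∣≤∣p∣+∣q∣ []            []            = z≤n
∣p∪q∣≤∣p∣+∣q∣ (outside ∷ p) (outside ∷ q) = ∣p∪q∣≤∣p∣+∣q∣ p q
∣p∪q∣≤∣p∣+∣q∣ (outside ∷ p) (inside  ∷ q) =
  ≤-trans (s≤s (∣p∪q∣≤∣p∣+∣q∣ p q)) (≤-reflexive (sym (+-suc ∣ p ∣ ∣ q ∣)))
∣p∪q∣≤∣p∣+∣q∣ (inside  ∷ p) (outside ∷ q) = s≤s (∣p∪q∣≤∣p∣+∣q∣ p q)
∣p∪q∣≤∣p∣+∣q∣ (inside  ∷ p) (inside  ∷ q) =
  s≤s (≤-trans (∣p∪q∣≤∣p∣+∣q∣ p q) (+-monoʳ-≤ ∣ p ∣ (n≤1+n ∣ q ∣)))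

⋃ᶠ : ∀ {n k} → (Fin n → Subset k) → Subset k
⋃ᶠ {zero}  g = ⊥
⋃ᶠ {suc n} g = g zero ∪ ⋃ᶠ (g ∘ suc)

∈⋃ᶠ : ∀ {n k} {g : Fin n → Subset k} {i} → Occurs g i → i ∈ ⋃ᶠ g
∈⋃ᶠ (zero  , i∈g) = x∈p∪q⁺ (inj₁ i∈g)
∈⋃ᶠ (suc j , i∈g) = x∈p∪q⁺ (inj₂ (∈⋃ᶠ (j , i∈g)))

union-bound : ∀ {n k} (g : Fin n → Subset k) → ∣ ⋃ᶠ g ∣ ≤ total g
union-bound {zero} {k} g = ≤-reflexive (∣⊥∣≡0 k)
union-bound {suc n} g =
  ≤-trans (∣p∪q∣≤∣p∣+∣q∣ (g zero) _) (+-monoʳ-≤ ∣ g zero ∣ (union-bound (g ∘ suc)))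

occurrence-bound : ∀ {n k} (g : Fin n → Subset k) (Y : Subset k) →
                   (∀ {i} → i ∈ Y → Occurs g i) → ∣ Y ∣ ≤ total (λ j → g j ∩ Y)
occurrence-bound g Y occurs = ≤-trans (p⊆q⇒∣p∣≤∣q∣ Y⊆⋃) (union-bound (λ j → g j ∩ Y))
  where
  Y⊆⋃ : Y ⊆ ⋃ᶠ (λ j → g j ∩ Y)
  Y⊆⋃ i∈Y with occurs i∈Y
  ... | j , i∈g = ∈⋃ᶠ (j , x∈p∩q⁺ (i∈g , i∈Y))

cover-bound : ∀ {n k} (g : Fin n → Subset k) → Covers g → k ≤ total g
cover-bound {k = k} g covers = begin
  k                        ≡⟨ sym (∣⊤∣≡n k) ⟩
  ∣ ⊤ {k} ∣                ≤⟨ occurrence-bound g ⊤ (λ {i} _ → covers i) ⟩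
  total (λ j → g j ∩ ⊤)    ≤⟨ ∑-mono (λ j → ∣p∩q∣≤∣p∣ (g j) ⊤) ⟩
  total g                  ∎
  where open ≤-Reasoning

-- Rainbow total domination of a single vertex with colour set p, where R i says
-- that colour i is available in its neighbourhood.
record Dominated {k} (p : Subset k) (R : Fin k → Set) : Set where
  field
    when-empty  : p ≡ ⊥ → ∀ i → R i
    when-single : ∀ i → p ≡ ⁅ i ⁆ → R i
open Dominated

dominated-mono : ∀ {k} {p : Subset k} {R R′ : Fin k → Set} →
                 (∀ {i} → R i → R′ i) → Dominated p R → Dominated p R′
dominated-mono R⇒R′ d = record
  { when-empty  = λ e i → R⇒R′ (when-empty d e i)
  ; when-single = λ i e → R⇒R′ (when-single d i e) }

dominated-by-all : ∀ {k} {p : Subset k} {R : Fin k → Set} → (∀ i → R i) → Dominated p R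
dominated-by-all all = record { when-empty = λ _ → all ; when-single = λ i _ → all i }

dominated-singleton : ∀ {k} {i} {R : Fin k → Set} → R i → Dominated ⁅ i ⁆ R
dominated-singleton {i = i} Ri = record
  { when-empty  = λ e → ⊥-elim (∉⊥ (subst (i ∈_) e (x∈⁅x⁆ i)))
  ; when-single = λ j e → subst _ (x∈⁅y⁆⇒x≡y j (subst (i ∈_) e (x∈⁅x⁆ i))) Ri }

dominated-large : ∀ {k} {p : Subset k} {R : Fin k → Set} → 2 ≤ ∣ p ∣ → Dominated p R
dominated-large {k} {p} 2≤p = record
  { when-empty  = λ e → ⊥-elim (<⇒≱ 2≤p (≤-trans (≤-reflexive (trans (cong ∣_∣ e) (∣⊥∣≡0 k))) z≤n))
  ; when-single = λ i e → ⊥-elim (<⇒≱ 2≤p (≤-reflexive (trans (cong ∣_∣ e) (∣⁅x⁆∣≡1 i)))) }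

NeighbourColour : ∀ {k} (G : Graph) → (Fin (Graph.n G) → Subset k) → Fin (Graph.n G) → Fin k → Set
NeighbourColour G f v i = ∃ λ u → Adj G v u × i ∈ f u

krtdf⇒dominated : ∀ {k G f} → IsKRTDF k G f → ∀ v → Dominated (f v) (NeighbourColour G f v)
krtdf⇒dominated F v = record { when-empty = empty-cond v ; when-single = single-cond v }
  where open IsKRTDF F

dominated⇒krtdf : ∀ {k G f} → (∀ v → Dominated (f v) (NeighbourColour G f v)) → IsKRTDF k G f
dominated⇒krtdf d = record
  { empty-cond  = λ v → when-empty (d v)
  ; single-cond = λ v → when-single (d v) }

weight≡total : ∀ {k} G (f : Fin (Graph.n G) → Subset k) → weight G f ≡ total f
weight≡total G f = trans (cong List.sum (map-tabulate (λ v → v) (λ v → ∣ f v ∣)))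
                         (listSum-tabulate (λ v → ∣ f v ∣))

data Part (a b : ℕ) : Fin (a + b) → Set where
  left  : ∀ j → Part a b (j ↑ˡ b)
  right : ∀ j → Part a b (a ↑ʳ j)

part : ∀ a b v → Part a b v
part a b v with splitAt a v in eq
... | inj₁ j = subst (Part a b) (splitAt⁻¹-↑ˡ eq) (left j)
... | inj₂ j = subst (Part a b) (splitAt⁻¹-↑ʳ eq) (right j)

module _ {a b : ℕ} where

  left<a : ∀ (j : Fin a) → toℕ (j ↑ˡ b) < a
  left<a j = subst (_< a) (sym (toℕ-↑ˡ j b)) (toℕ<n j)

  a≤right : ∀ (j : Fin b) → a ≤ toℕ (a ↑ʳ j)
  a≤right j = subst (a ≤_) (sym (toℕ-↑ʳ a j)) (m≤m+n a (toℕ j))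

  left-right : ∀ (j : Fin a) (j′ : Fin b) → Adj (K a b) (j ↑ˡ b) (a ↑ʳ j′)
  left-right j j′ = inj₁ (left<a j , a≤right j′)

  right-left : ∀ (j : Fin b) (j′ : Fin a) → Adj (K a b) (a ↑ʳ j) (j′ ↑ˡ b)
  right-left j j′ = inj₂ (a≤right j , left<a j′)

  left-left : ∀ (j j′ : Fin a) → ¬ Adj (K a b) (j ↑ˡ b) (j′ ↑ˡ b)
  left-left j j′ (inj₁ (_ , a≤j′)) = <⇒≱ (left<a j′) a≤j′
  left-left j j′ (inj₂ (a≤j , _))  = <⇒≱ (left<a j) a≤j

  right-right : ∀ (j j′ : Fin b) → ¬ Adj (K a b) (a ↑ʳ j) (a ↑ʳ j′)
  right-right j j′ (inj₁ (j<a , _))  = <⇒≱ j<a (a≤right j)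
  right-right j j′ (inj₂ (_ , j′<a)) = <⇒≱ j′<a (a≤right j′)

  seen-from-left : ∀ {k} (f : Fin (a + b) → Subset k) (j : Fin a) {i} →
                   NeighbourColour (K a b) f (j ↑ˡ b) i → Occurs (f ∘ (a ↑ʳ_)) i
  seen-from-left f j (u , adj , i∈fu) with part a b u
  ... | left j′  = ⊥-elim (left-left j j′ adj)
  ... | right j′ = j′ , i∈fu

  seen-from-right : ∀ {k} (f : Fin (a + b) → Subset k) (j : Fin b) {i} →
                    NeighbourColour (K a b) f (a ↑ʳ j) i → Occurs (f ∘ (_↑ˡ b)) i
  seen-from-right f j (u , adj , i∈fu) with part a b u
  ... | left j′  = j′ , i∈fu
  ... | right j′ = ⊥-elim (right-right j j′ adj)

  ++-left : ∀ {A : Set} (g : Fin a → A) (h : Fin b → A) j → (g ++ h) (j ↑ˡ b) ≡ g j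
  ++-left g h j = cong [ g , h ] (splitAt-↑ˡ a j b)

  ++-right : ∀ {A : Set} (g : Fin a → A) (h : Fin b → A) j → (g ++ h) (a ↑ʳ j) ≡ h j
  ++-right g h j = cong [ g , h ] (splitAt-↑ʳ a b j)

  total-split : ∀ {k} (f : Fin (a + b) → Subset k) → total f ≡ total (f ∘ (_↑ˡ b)) + total (f ∘ (a ↑ʳ_))
  total-split f = ∑-split a (λ v → ∣ f v ∣)

  total-++ : ∀ {k} (g : Fin a → Subset k) (h : Fin b → Subset k) → total (g ++ h) ≡ total g + total h
  total-++ g h = trans (total-split (g ++ h))
    (cong₂ _+_ (sum-cong-≗ (cong ∣_∣ ∘ ++-left g h)) (sum-cong-≗ (cong ∣_∣ ∘ ++-right g h)))

record BipartiteRTDF {k a b} (gA : Fin a → Subset k) (gB : Fin b → Subset k) : Set where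
  field
    left-dominated  : ∀ j → Dominated (gA j) (Occurs gB)
    right-dominated : ∀ j → Dominated (gB j) (Occurs gA)
open BipartiteRTDF

swap-parts : ∀ {k a b} {gA : Fin a → Subset k} {gB : Fin b → Subset k} →
             BipartiteRTDF gA gB → BipartiteRTDF gB gA
swap-parts D = record { left-dominated = right-dominated D ; right-dominated = left-dominated D }

restrict : ∀ {k a b} {f : Fin (a + b) → Subset k} → IsKRTDF k (K a b) f →
           BipartiteRTDF (f ∘ (_↑ˡ b)) (f ∘ (a ↑ʳ_))
restrict {f = f} F = record
  { left-dominated  = λ j → dominated-mono (seen-from-left f j) (krtdf⇒dominated F (j ↑ˡ _))
  ; right-dominated = λ j → dominated-mono (seen-from-right f j) (krtdf⇒dominated F (_ ↑ʳ j)) }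

glue : ∀ {k a b} {gA : Fin a → Subset k} {gB : Fin b → Subset k} →
       BipartiteRTDF gA gB → IsKRTDF k (K a b) (gA ++ gB)
glue {k} {a} {b} {gA} {gB} D = dominated⇒krtdf dominated
  where
  f : Fin (a + b) → Subset k
  f = gA ++ gB
  dominated : ∀ v → Dominated (f v) (NeighbourColour (K a b) f v)
  dominated v with part a b v
  ... | left j = subst (λ p → Dominated p (NeighbourColour (K a b) f (j ↑ˡ b)))
      (sym (++-left gA gB j)) (dominated-mono seen (left-dominated D j))
    where
    seen : ∀ {i} → Occurs gB i → NeighbourColour (K a b) f (j ↑ˡ b) i
    seen (j′ , i∈gB) = a ↑ʳ j′ , left-right j j′ , subst (_ ∈_) (sym (++-right gA gB j′)) i∈gB
  ... | right j = subst (λ p → Dominated p (NeighbourColour (K a b) f (a ↑ʳ j)))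
      (sym (++-right gA gB j)) (dominated-mono seen (right-dominated D j))
    where
    seen : ∀ {i} → Occurs gA i → NeighbourColour (K a b) f (a ↑ʳ j) i
    seen (j′ , i∈gA) = j′ ↑ˡ b , right-left j j′ , subst (_ ∈_) (sym (++-left gA gB j′)) i∈gA

-- Lower bounds.

nonempty-bound : ∀ {n k} (g : Fin n → Subset k) → (∀ j → ¬ g j ≡ ⊥) → n ≤ total g
nonempty-bound {n} g nonempty =
  ≤-trans (≤-reflexive (sym (*-identityʳ n))) (∑-lower (λ j → nonempty⇒positive (g j) (nonempty j)))

vertex-bound : ∀ {k} (p Y : Subset k) → ¬ p ≡ ⊥ → (∀ i → p ≡ ⁅ i ⁆ → i ∉ Y) →
               ∣ p ∩ Y ∣ + 2 ≤ ∣ p ∣ + ∣ p ∣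
vertex-bound {k} p Y p≢⊥ avoid with shape p
... | empty e       = ⊥-elim (p≢⊥ e)
... | large l       = +-mono-≤ (∣p∩q∣≤∣p∣ p Y) l
... | singleton i e = begin
  ∣ p ∩ Y ∣ + 2   ≤⟨ +-monoˡ-≤ 2 (≤-trans (p⊆q⇒∣p∣≤∣q∣ p∩Y⊆⊥) (≤-reflexive (∣⊥∣≡0 k))) ⟩
  2               ≡⟨ sym (cong₂ _+_ ∣p∣≡1 ∣p∣≡1) ⟩
  ∣ p ∣ + ∣ p ∣   ∎
  where
  open ≤-Reasoning
  ∣p∣≡1 : ∣ p ∣ ≡ 1
  ∣p∣≡1 = trans (cong ∣_∣ e) (∣⁅x⁆∣≡1 i)
  p∩Y⊆⊥ : p ∩ Y ⊆ ⊥
  p∩Y⊆⊥ {x} x∈p∩Y with x∈p∩q⁻ p Y x∈p∩Y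
  ... | x∈p , x∈Y = ⊥-elim (avoid i e (subst (_∈ Y) (x∈⁅y⁆⇒x≡y i (subst (x ∈_) e x∈p)) x∈Y))

-- The counting step of 'one-sided': |X| = x + 1 ≤ wB, |X| + |Y| = k and
-- 2a + |Y| ≤ 2 wA give 2a + k + 1 ≤ 2 wA + 2 wB.
double-count : ∀ {a x y k wA wB} → y + a * 2 ≤ wA + wA → suc x ≤ wB → suc x + y ≡ k →
               (a + a) + (k + 1) ≤ (wA + wA) + (wB + wB)
double-count {a} {x} {y} {wA = wA} {wB} Y≤ X≤ refl = begin
  (a + a) + ((suc x + y) + 1)   ≡⟨ rearrange a x y ⟩
  (y + a * 2) + (suc x + 1)     ≤⟨ +-mono-≤ Y≤ (+-mono-≤ X≤ (≤-trans (s≤s z≤n) X≤)) ⟩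
  (wA + wA) + (wB + wB)         ∎
  where
  open ≤-Reasoning
  rearrange : ∀ a x y → (a + a) + ((suc x + y) + 1) ≡ (y + a * 2) + (suc x + 1)
  rearrange = solve-∀

-- No A-set is
-- empty and a singleton A-set has its colour on B, so summing 'vertex-bound' over
-- A, which covers Y, gives |Y| + 2a ≤ 2 wA.
absent-colours-bound : ∀ {k a b} {gA : Fin a → Subset k} {gB : Fin b → Subset k} →
                       BipartiteRTDF gA gB → Covers gA → ¬ Covers gB →
                       ∣ ∁ (⋃ᶠ gB) ∣ + a * 2 ≤ total gA + total gA
absent-colours-bound {k} {a} {b} {gA} {gB} D coversA uncoveredB = begin
  ∣ Y ∣ + a * 2
    ≤⟨ +-monoˡ-≤ (a * 2) (occurrence-bound gA Y (λ {i} _ → coversA i)) ⟩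
  total (λ j → gA j ∩ Y) + a * 2
    ≡⟨ cong (total (λ j → gA j ∩ Y) +_) (sym (∑-const a 2)) ⟩
  total (λ j → gA j ∩ Y) + sum {a} (λ _ → 2)
    ≡⟨ sym (∑-distrib-+ (λ j → ∣ gA j ∩ Y ∣) (λ _ → 2)) ⟩
  sum (λ j → ∣ gA j ∩ Y ∣ + 2)
    ≤⟨ ∑-mono (λ j → vertex-bound (gA j) Y (nonempty j) (avoids-Y j)) ⟩
  sum (λ j → ∣ gA j ∣ + ∣ gA j ∣)
    ≡⟨ ∑-distrib-+ (λ j → ∣ gA j ∣) (λ j → ∣ gA j ∣) ⟩
  total gA + total gA ∎
  where
  open ≤-Reasoning
  Y : Subset k
  Y = ∁ (⋃ᶠ gB)
  nonempty : ∀ j → ¬ gA j ≡ ⊥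
  nonempty j e = uncoveredB (when-empty (left-dominated D j) e)
  avoids-Y : ∀ j i → gA j ≡ ⁅ i ⁆ → i ∉ Y
  avoids-Y j i e = x∈p⇒x∉∁p (∈⋃ᶠ (when-single (left-dominated D j) i e))

-- If only part A covers all colours: with X the colours on B, wB ≥ |X| and
-- |X| + |∁ X| = k, so 2W ≥ 2a + k + 1 unless X is empty, in which case no A-set
-- can be a singleton and every A-set has at least two colours.
one-sided : ∀ {k a b} {gA : Fin a → Subset k} {gB : Fin b → Subset k} →
            BipartiteRTDF gA gB → Covers gA → ¬ Covers gB →
            (a + a) + (k + 1) ≤ (total gA + total gA) + (total gB + total gB) ⊎ a * 2 ≤ total gA
one-sided {k} {a} {b} {gA} {gB} D coversA uncoveredB with ∣ ⋃ᶠ gB ∣ in ∣X∣≡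
... | suc x = inj₁ (double-count {a} {x} {∣ ∁ (⋃ᶠ gB) ∣} {k} {total gA} {total gB}
                      (absent-colours-bound D coversA uncoveredB)
                      (subst (_≤ total gB) ∣X∣≡ (union-bound gB))
                      (subst (λ z → z + ∣ ∁ (⋃ᶠ gB) ∣ ≡ k) ∣X∣≡ (∣p∣+∣∁p∣≡n (⋃ᶠ gB))))
... | zero = inj₂ (∑-lower at-least-two)
  where
  at-least-two : ∀ j → 2 ≤ ∣ gA j ∣
  at-least-two j with shape (gA j)
  ... | empty e       = ⊥-elim (uncoveredB (when-empty (left-dominated D j) e))
  ... | singleton i e = ⊥-elim (<⇒≱ (member⇒positive (∈⋃ᶠ (when-single (left-dominated D j) i e)))
                                     (≤-reflexive ∣X∣≡))
  ... | large l       = l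

one-part-covers : ∀ {k a b} {gA : Fin a → Subset k} {gB : Fin b → Subset k} →
                  BipartiteRTDF gA gB → Covers gA → ¬ Covers gB →
                  a + ⌈ k + 1 /2⌉ ≤ total gA + total gB ⊎ a + a ≤ total gA + total gB
one-part-covers {k} {a} {gA = gA} {gB} D coversA uncoveredB with one-sided D coversA uncoveredB
... | inj₁ h = inj₁ (halve a (k + 1) (total gA + total gB)
                       (≤-trans h (≤-reflexive (interchange (total gA) (total gB)))))
  where
  interchange : ∀ x y → (x + x) + (y + y) ≡ (x + y) + (x + y)
  interchange = solve-∀
... | inj₂ h = inj₂ (≤-trans (≤-reflexive (sym (double a))) (≤-trans h (m≤m+n (total gA) (total gB))))

Admissible : ℕ → ℕ → ℕ → ℕ → Set
Admissible k a b W = k + k ≤ W ⊎ a + b ≤ W ⊎ (k ≤ W × (a + ⌈ k + 1 /2⌉ ≤ W ⊎ a + a ≤ W))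

bipartite-admissible : ∀ {k a b} {gA : Fin a → Subset k} {gB : Fin b → Subset k} → a ≤ b →
                       BipartiteRTDF gA gB → Admissible k a b (total gA + total gB)
bipartite-admissible {k} {a} {b} {gA} {gB} a≤b D with covers? gA | covers? gB
... | yes coversA | yes coversB = inj₁ (+-mono-≤ (cover-bound gA coversA) (cover-bound gB coversB))
... | no uncoveredA | no uncoveredB = inj₂ (inj₁ (+-mono-≤
      (nonempty-bound gA (λ j e → uncoveredB (when-empty (left-dominated D j) e)))
      (nonempty-bound gB (λ j e → uncoveredA (when-empty (right-dominated D j) e)))))
... | yes coversA | no uncoveredB = inj₂ (inj₂
      (≤-trans (cover-bound gA coversA) (m≤m+n (total gA) (total gB)) ,
       one-part-covers D coversA uncoveredB))
... | no uncoveredA | yes coversB = inj₂ (inj₂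
      (≤-trans (cover-bound gB coversB) (m≤n+m (total gB) (total gA)) ,
       smaller-part (subst (λ W → b + ⌈ k + 1 /2⌉ ≤ W ⊎ b + b ≤ W) (+-comm (total gB) (total gA))
                           (one-part-covers (swap-parts D) coversB uncoveredA))))
  where
  smaller-part : ∀ {W} → b + ⌈ k + 1 /2⌉ ≤ W ⊎ b + b ≤ W → a + ⌈ k + 1 /2⌉ ≤ W ⊎ a + a ≤ W
  smaller-part (inj₁ h) = inj₁ (≤-trans (+-monoˡ-≤ ⌈ k + 1 /2⌉ a≤b) h)
  smaller-part (inj₂ h) = inj₂ (≤-trans (+-mono-≤ a≤b a≤b) h)

krtdf-admissible : ∀ {k a b} {f : Fin (a + b) → Subset k} → a ≤ b →
                   IsKRTDF k (K a b) f → Admissible k a b (weight (K a b) f)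
krtdf-admissible {k} {a} {b} {f} a≤b F =
  subst (Admissible k a b) (sym (trans (weight≡total (K a b) f) (total-split {a} {b} f)))
        (bipartite-admissible a≤b (restrict F))

admissible-lower : ∀ {k a b L W} → L ≤ k + k → L ≤ a + b →
                   L ≤ k ⊎ (L ≤ a + ⌈ k + 1 /2⌉ × L ≤ a + a) → Admissible k a b W → L ≤ W
admissible-lower L≤2k _ _ (inj₁ h) = ≤-trans L≤2k h
admissible-lower _ L≤a+b _ (inj₂ (inj₁ h)) = ≤-trans L≤a+b h
admissible-lower _ _ (inj₁ L≤k) (inj₂ (inj₂ (h , _))) = ≤-trans L≤k h
admissible-lower _ _ (inj₂ (L≤ , _)) (inj₂ (inj₂ (_ , inj₁ h))) = ≤-trans L≤ h
admissible-lower _ _ (inj₂ (_ , L≤)) (inj₂ (inj₂ (_ , inj₂ h))) = ≤-trans L≤ h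

-- Upper bounds: explicit bipartite RTDFs.

Realisable : ℕ → ℕ → ℕ → ℕ → Set
Realisable k a b w = Σ (Fin (a + b) → Subset k) λ f → IsKRTDF k (K a b) f × weight (K a b) f ≡ w

realise : ∀ {k a b w} {gA : Fin a → Subset k} {gB : Fin b → Subset k} →
          BipartiteRTDF gA gB → total gA + total gB ≡ w → Realisable k a b w
realise {a = a} {b} {gA = gA} {gB} D total≡w =
  gA ++ gB , glue D , trans (weight≡total (K a b) (gA ++ gB)) (trans (total-++ gA gB) total≡w)

total-empty : ∀ {n k} → total {n} (λ _ → ⊥ {k}) ≡ 0
total-empty {n} {k} = trans (∑-const n ∣ ⊥ {k} ∣) (trans (cong (n *_) (∣⊥∣≡0 k)) (*-zeroʳ n))

total-singletons : ∀ {n k} (i : Fin k) → total {n} (λ _ → ⁅ i ⁆) ≡ n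
total-singletons {n} i = trans (∑-const n ∣ ⁅ i ⁆ ∣) (trans (cong (n *_) (∣⁅x⁆∣≡1 i)) (*-identityʳ n))

concentrated : ∀ {n k} → Subset k → Fin (suc n) → Subset k
concentrated p zero    = p
concentrated p (suc _) = ⊥

total-concentrated : ∀ {n k} (p : Subset k) → total {suc n} (concentrated p) ≡ ∣ p ∣
total-concentrated {n} {k} p = trans (cong (∣ p ∣ +_) (total-empty {n} {k})) (+-identityʳ ∣ p ∣)

dominated-++ : ∀ {k a b} {g : Fin a → Subset k} {h : Fin b → Subset k} {R : Fin k → Set} →
               (∀ j → Dominated (g j) R) → (∀ j → Dominated (h j) R) → ∀ v → Dominated ((g ++ h) v) R
dominated-++ {a = a} {b} {g} {h} {R} dg dh v with part a b v
... | left j  = subst (λ p → Dominated p R) (sym (++-left g h j)) (dg j)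
... | right j = subst (λ p → Dominated p R) (sym (++-right g h j)) (dh j)

record Blocks (m n : ℕ) : Set where
  field
    block      : Fin m → Subset n
    covering   : Covers block
    two-each   : ∀ j → 2 ≤ ∣ block j ∣
    total-size : total block ≡ n
open Blocks

-- Such blocks exist as soon as 1 ≤ m and 2m ≤ n: pair off the colours and put
-- the remaining ones into the last block.
blocks : ∀ m n → 1 ≤ m → m + m ≤ n → Blocks m n
blocks (suc zero) n _ 2≤n = record
  { block      = λ _ → ⊤
  ; covering   = λ i → zero , ∈⊤
  ; two-each   = λ _ → subst (2 ≤_) (sym (∣⊤∣≡n n)) 2≤n
  ; total-size = trans (+-identityʳ ∣ ⊤ {n} ∣) (∣⊤∣≡n n) }
blocks (suc (suc m)) (suc (suc n)) _ (s≤s (s≤s m+m≤n)) = record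
  { block      = pair-then-rest
  ; covering   = covered
  ; two-each   = λ { zero → s≤s (s≤s z≤n) ; (suc j) → two-each rest j }
  ; total-size = cong₂ _+_ (cong (λ z → suc (suc z)) (∣⊥∣≡0 n)) (total-size rest) }
  where
  rest : Blocks (suc m) n
  rest = blocks (suc m) n (s≤s z≤n) (subst (_≤ n) (+-suc m (suc m)) m+m≤n)
  pair-then-rest : Fin (suc (suc m)) → Subset (suc (suc n))
  pair-then-rest zero    = inside ∷ inside ∷ ⊥
  pair-then-rest (suc j) = outside ∷ outside ∷ block rest j
  covered : Covers pair-then-rest
  covered zero          = zero , here
  covered (suc zero)    = zero , there here
  covered (suc (suc i)) with covering rest i
  ... | j , i∈block = suc j , there (there i∈block)
blocks (suc (suc m)) zero          _ ()
blocks (suc (suc m)) (suc zero)    _ (s≤s ())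

realise-a+b : ∀ {k a b} → 1 ≤ k → 1 ≤ a → 1 ≤ b → Realisable k a b (a + b)
realise-a+b {suc k} {suc a} {suc b} _ _ _ =
  realise {gA = λ _ → ⁅ zero {k} ⁆} {gB = λ _ → ⁅ zero ⁆}
    (record { left-dominated  = λ _ → dominated-singleton (zero , x∈⁅x⁆ zero)
            ; right-dominated = λ _ → dominated-singleton (zero , x∈⁅x⁆ zero) })
    (cong₂ _+_ (total-singletons {suc a} {suc k} zero) (total-singletons {suc b} {suc k} zero))

realise-k : ∀ {k a b} → 1 ≤ a → a + a ≤ k → Realisable k a b k
realise-k {k} {a} {b} 1≤a a+a≤k =
  realise {gA = block B} {gB = λ _ → ⊥ {k}}
    (record { left-dominated  = λ j → dominated-large (two-each B j)
            ; right-dominated = λ _ → dominated-by-all (covering B) })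
    (trans (cong₂ _+_ (total-size B) (total-empty {b} {k})) (+-identityʳ k))
  where
  B : Blocks a k
  B = blocks a k 1≤a a+a≤k

realise-2k : ∀ {k a b} → 1 ≤ a → 1 ≤ b → Realisable k a b (k + k)
realise-2k {k} {suc a} {suc b} _ _ =
  realise {gA = concentrated (⊤ {k})} {gB = concentrated (⊤ {k})}
    (record { left-dominated  = λ _ → dominated-by-all (λ _ → zero , ∈⊤)
            ; right-dominated = λ _ → dominated-by-all (λ _ → zero , ∈⊤) })
    (cong₂ _+_ (trans (total-concentrated {a} {k} ⊤) (∣⊤∣≡n k))
               (trans (total-concentrated {b} {k} ⊤) (∣⊤∣≡n k)))

-- Weight k + r on K (m + r) b: colours 1, …, k-1 in m blocks of at least two on
-- the first m vertices of A, colour 0 alone on the other r vertices of A and on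
-- one vertex of B.
realise-middle : ∀ {k m r b} → 1 ≤ m → m + m < k → 1 ≤ r → 1 ≤ b → Realisable k (m + r) b (k + r)
realise-middle {suc k} {m} {suc r} {suc b} 1≤m (s≤s m+m≤k) _ _ = realise D weight≡
  where
  B : Blocks m k
  B = blocks m k 1≤m m+m≤k
  gA : Fin (m + suc r) → Subset (suc k)
  gA = (λ j → outside ∷ block B j) ++ (λ _ → ⁅ zero ⁆)
  gB : Fin (suc b) → Subset (suc k)
  gB = concentrated ⁅ zero ⁆
  coversA : Covers gA
  coversA zero = m ↑ʳ zero , subst (zero ∈_) (sym (++-right (λ j → outside ∷ block B j) _ zero)) here
  coversA (suc i) with covering B i
  ... | j , i∈block = j ↑ˡ suc r , subst (suc i ∈_) (sym (++-left _ (λ _ → ⁅ zero ⁆) j)) (there i∈block)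
  D : BipartiteRTDF gA gB
  D = record
    { left-dominated  = dominated-++ (λ j → dominated-large (two-each B j))
                                     (λ _ → dominated-singleton (zero , here))
    ; right-dominated = λ { zero → dominated-singleton (coversA zero)
                          ; (suc _) → dominated-by-all coversA } }
  weight≡ : total gA + total gB ≡ suc k + suc r
  weight≡ = begin
    total gA + total gB
      ≡⟨ cong₂ _+_ (total-++ (λ j → outside ∷ block B j) (λ _ → ⁅ zero ⁆))
                   (total-concentrated {b} ⁅ zero {k} ⁆) ⟩
    (total (block B) + total {suc r} (λ _ → ⁅ zero {k} ⁆)) + ∣ ⁅ zero {k} ⁆ ∣
      ≡⟨ cong₂ _+_ (cong₂ _+_ (total-size B) (total-singletons {suc r} {suc k} zero))
                   (∣⁅x⁆∣≡1 {suc k} zero) ⟩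
    (k + suc r) + 1
      ≡⟨ +-comm (k + suc r) 1 ⟩
    suc k + suc r ∎
    where open ≡-Reasoning

⌈k+1/2⌉≡1+⌊k/2⌋ : ∀ k → ⌈ k + 1 /2⌉ ≡ suc ⌊ k /2⌋
⌈k+1/2⌉≡1+⌊k/2⌋ k = cong ⌈_/2⌉ (+-comm k 1)

⌊n/2⌋+⌊n/2⌋≤n : ∀ n → ⌊ n /2⌋ + ⌊ n /2⌋ ≤ n
⌊n/2⌋+⌊n/2⌋≤n n = ≤-trans (+-monoʳ-≤ ⌊ n /2⌋ (⌊n/2⌋≤⌈n/2⌉ n)) (≤-reflexive (⌊n/2⌋+⌈n/2⌉≡n n))

n≤⌈n/2⌉+⌈n/2⌉ : ∀ n → n ≤ ⌈ n /2⌉ + ⌈ n /2⌉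
n≤⌈n/2⌉+⌈n/2⌉ n = ≤-trans (≤-reflexive (sym (⌊n/2⌋+⌈n/2⌉≡n n))) (+-monoˡ-≤ ⌈ n /2⌉ (⌊n/2⌋≤⌈n/2⌉ n))

⌈k+1/2⌉≤k : ∀ {k} → 1 ≤ k → ⌈ k + 1 /2⌉ ≤ k
⌈k+1/2⌉≤k {suc j} _ = subst (_≤ suc j) (sym (⌈k+1/2⌉≡1+⌊k/2⌋ (suc j))) (⌊n/2⌋<n j)

⌈k+1/2⌉≤ : ∀ {k a} → ⌊ k /2⌋ < a → ⌈ k + 1 /2⌉ ≤ a
⌈k+1/2⌉≤ {k} {a} = subst (_≤ a) (sym (⌈k+1/2⌉≡1+⌊k/2⌋ k))

thresholds-sum : ∀ {k} → 2 ≤ k → ⌈ 3 * k ∸ 2 /2⌉ + ⌈ k + 1 /2⌉ ≡ k + k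
thresholds-sum {suc (suc j)} (s≤s (s≤s z≤n)) = begin
  ⌈ 3 * k ∸ 2 /2⌉ + ⌈ k + 1 /2⌉
    ≡⟨ cong₂ _+_ (cong ⌈_/2⌉ (three-k∸2 j)) (⌈k+1/2⌉≡1+⌊k/2⌋ k) ⟩
  ⌈ (k + k) + j /2⌉ + suc (suc ⌊ j /2⌋)
    ≡⟨ cong (_+ suc (suc ⌊ j /2⌋)) (⌈m+m+n/2⌉ k j) ⟩
  (k + ⌈ j /2⌉) + suc (suc ⌊ j /2⌋)
    ≡⟨ rearrange k ⌈ j /2⌉ ⌊ j /2⌋ ⟩
  k + suc (suc (⌊ j /2⌋ + ⌈ j /2⌉))
    ≡⟨ cong (λ z → k + suc (suc z)) (⌊n/2⌋+⌈n/2⌉≡n j) ⟩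
  k + k ∎
  where
  open ≡-Reasoning
  k : ℕ
  k = suc (suc j)
  -- 3k - 2 = 2k + (k - 2), here by unfolding 3 * k ∸ 2.
  three-k∸2 : ∀ j → j + (suc (suc j) + (suc (suc j) + 0)) ≡ (suc (suc j) + suc (suc j)) + j
  three-k∸2 = solve-∀
  rearrange : ∀ k c f → (k + c) + suc (suc f) ≡ k + suc (suc (f + c))
  rearrange = solve-∀

k≤⌈3k∸2/2⌉ : ∀ {k} → 2 ≤ k → k ≤ ⌈ 3 * k ∸ 2 /2⌉
k≤⌈3k∸2/2⌉ {k} 2≤k = +-cancelʳ-≤ ⌈ k + 1 /2⌉ k ⌈ 3 * k ∸ 2 /2⌉ (begin
  k + ⌈ k + 1 /2⌉               ≤⟨ +-monoʳ-≤ k (⌈k+1/2⌉≤k (≤-trans (s≤s z≤n) 2≤k)) ⟩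
  k + k                         ≡⟨ sym (thresholds-sum 2≤k) ⟩
  ⌈ 3 * k ∸ 2 /2⌉ + ⌈ k + 1 /2⌉ ∎)
  where open ≤-Reasoning

-- In the middle range ⌈(k+1)/2⌉ < k, since 2⌈(k+1)/2⌉ < U + ⌈(k+1)/2⌉ = 2k.
⌈k+1/2⌉<k : ∀ {k a} → 2 ≤ k → ⌊ k /2⌋ < a → a < ⌈ 3 * k ∸ 2 /2⌉ → ⌈ k + 1 /2⌉ < k
⌈k+1/2⌉<k {k} 2≤k ⌊k/2⌋<a a<U = ≰⇒> λ k≤C → <⇒≱ C+C<k+k (+-mono-≤ k≤C k≤C)
  where
  C+C<k+k : ⌈ k + 1 /2⌉ + ⌈ k + 1 /2⌉ < k + k
  C+C<k+k = <-≤-trans (+-monoˡ-< ⌈ k + 1 /2⌉ (≤-<-trans (⌈k+1/2⌉≤ ⌊k/2⌋<a) a<U))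
                      (≤-reflexive (thresholds-sum 2≤k))

k∸⌈k+1/2⌉<⌈k+1/2⌉ : ∀ {k} → ⌈ k + 1 /2⌉ ≤ k → k ∸ ⌈ k + 1 /2⌉ < ⌈ k + 1 /2⌉
k∸⌈k+1/2⌉<⌈k+1/2⌉ {k} C≤k = +-cancelʳ-< C (k ∸ C) C
  (subst (_< C + C) (sym (m∸n+n≡m C≤k)) (subst (_≤ C + C) (+-comm k 1) (n≤⌈n/2⌉+⌈n/2⌉ (k + 1))))
  where
  C : ℕ
  C = ⌈ k + 1 /2⌉

-- For ⌊k/2⌋ < a < ⌈(3k-2)/2⌉ the middle construction with m = k - ⌈(k+1)/2⌉
-- blocks and r = a - m singleton vertices has weight a + ⌈(k+1)/2⌉.
realise-middle-range : ∀ {k a b} → 2 ≤ k → ⌊ k /2⌋ < a → a < ⌈ 3 * k ∸ 2 /2⌉ → 1 ≤ b →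
                       Realisable k a b (a + ⌈ k + 1 /2⌉)
realise-middle-range {k} {a} {b} 2≤k ⌊k/2⌋<a a<U 1≤b =
  subst₂ (λ x w → Realisable k x b w) m+r≡a k+r≡a+C (realise-middle 1≤m m+m<k 1≤r 1≤b)
  where
  C : ℕ
  C = ⌈ k + 1 /2⌉
  C≤a : C ≤ a
  C≤a = ⌈k+1/2⌉≤ ⌊k/2⌋<a
  C<k : C < k
  C<k = ⌈k+1/2⌉<k 2≤k ⌊k/2⌋<a a<U
  m : ℕ
  m = k ∸ C
  m+C≡k : m + C ≡ k
  m+C≡k = m∸n+n≡m (<⇒≤ C<k)
  m<C : m < C
  m<C = k∸⌈k+1/2⌉<⌈k+1/2⌉ (<⇒≤ C<k)
  1≤m : 1 ≤ m
  1≤m = m<n⇒0<n∸m C<k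
  m+m<k : m + m < k
  m+m<k = subst (m + m <_) m+C≡k (+-monoʳ-< m m<C)
  r : ℕ
  r = a ∸ m
  m<a : m < a
  m<a = <-≤-trans m<C C≤a
  1≤r : 1 ≤ r
  1≤r = m<n⇒0<n∸m m<a
  m+r≡a : m + r ≡ a
  m+r≡a = m+[n∸m]≡n (<⇒≤ m<a)
  k+r≡a+C : k + r ≡ a + C
  k+r≡a+C = begin
    k + r          ≡⟨ cong (_+ r) (sym m+C≡k) ⟩
    (m + C) + r    ≡⟨ swap m C r ⟩
    (m + r) + C    ≡⟨ cong (_+ C) m+r≡a ⟩
    a + C          ∎
    where
    open ≡-Reasoning
    swap : ∀ m c r → (m + c) + r ≡ (m + r) + c
    swap = solve-∀

proposition3 : ∀ (a b k : ℕ) → 1 ≤ a → 2 ≤ k → a ≤ b →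
    (a + b ≤ k → γkrt≡ k (K a b) (a + b))
    × (k < a + b →
        (a ≤ ⌊ k /2⌋ → γkrt≡ k (K a b) k)
        × (⌊ k /2⌋ < a → a < ⌈ 3 * k ∸ 2 /2⌉ → γkrt≡ k (K a b) (a + ⌈ k + 1 /2⌉))
        × (⌈ 3 * k ∸ 2 /2⌉ ≤ a → γkrt≡ k (K a b) (2 * k)))
proposition3 a b k 1≤a 2≤k a≤b = small , λ k<a+b → few k<a+b , middle , many
  where
  C U : ℕ
  C = ⌈ k + 1 /2⌉
  U = ⌈ 3 * k ∸ 2 /2⌉
  1≤b : 1 ≤ b
  1≤b = ≤-trans 1≤a a≤b

  lower : ∀ {L} → L ≤ k + k → L ≤ a + b → L ≤ k ⊎ (L ≤ a + C × L ≤ a + a) →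
          ∀ f → IsKRTDF k (K a b) f → L ≤ weight (K a b) f
  lower L≤2k L≤a+b L≤third f F = admissible-lower L≤2k L≤a+b L≤third (krtdf-admissible a≤b F)

  small : a + b ≤ k → γkrt≡ k (K a b) (a + b)
  small a+b≤k = realise-a+b (≤-trans (s≤s z≤n) 2≤k) 1≤a 1≤b ,
                lower (≤-trans a+b≤k (m≤m+n k k)) ≤-refl (inj₁ a+b≤k)

  few : k < a + b → a ≤ ⌊ k /2⌋ → γkrt≡ k (K a b) k
  few k<a+b a≤⌊k/2⌋ =
    realise-k 1≤a (≤-trans (+-mono-≤ a≤⌊k/2⌋ a≤⌊k/2⌋) (⌊n/2⌋+⌊n/2⌋≤n k)) ,
    lower (m≤m+n k k) (<⇒≤ k<a+b) (inj₁ ≤-refl)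

  middle : ⌊ k /2⌋ < a → a < U → γkrt≡ k (K a b) (a + C)
  middle ⌊k/2⌋<a a<U =
    realise-middle-range 2≤k ⌊k/2⌋<a a<U 1≤b ,
    lower (≤-trans (<⇒≤ (+-monoˡ-< C a<U)) (≤-reflexive (thresholds-sum 2≤k)))
          (+-monoʳ-≤ a (≤-trans (⌈k+1/2⌉≤ ⌊k/2⌋<a) a≤b))
          (inj₂ (≤-refl , +-monoʳ-≤ a (⌈k+1/2⌉≤ ⌊k/2⌋<a)))

  many : U ≤ a → γkrt≡ k (K a b) (2 * k)
  many U≤a = subst (γkrt≡ k (K a b)) (sym (cong (k +_) (+-identityʳ k)))
    (realise-2k 1≤a 1≤b ,
     lower ≤-refl (+-mono-≤ k≤a (≤-trans k≤a a≤b))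
           (inj₂ (≤-trans (≤-reflexive (sym (thresholds-sum 2≤k))) (+-monoˡ-≤ C U≤a) ,
                  +-mono-≤ k≤a k≤a)))
    where
    k≤a : k ≤ a
    k≤a = ≤-trans (k≤⌈3k∸2/2⌉ 2≤k) U≤a
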